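{- Let $d\neq 0$, $a\neq 0$ and $b$ be complex constants. Each of the following formal bilateral series is self-orthogonal: $$f(x,y)=x-y,\qquad f(x,y)=(y-x)\Big(1-\frac{xy}{d}\Big),\qquad f(x,y)=(x-y)\Big(1-\frac{b}{axy}\Big).$$
   Context: A formal bilateral series in $x,y$ is an expression $\sum_{i,j\in\mathbb{Z}}\lambda(i,j)x^iy^j$ with complex coefficients. For two such series $f,g$, $f\perp g$ means $$g(a',b')f(x',c')-g(a',c')f(x',b')+g(b',c')f(x',a')=0$$ identically in four independent variables $a',b',c',x'$; $f$ is self-orthogonal if $f\perp f$. -}

module Defs where

open import Level using (Level; _⊔_; suc)
open import Algebra.Bundles using (CommutativeRing)
open import Relation.Nullary using (¬_)

-- A field: a commutative ring with 1 ≉ 0 and multiplicative inverses of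
-- nonzero elements (the inverse function is total; its value at 0 is
-- irrelevant).  The complex numbers ℂ are the intended instance.
record Field (c ℓ : Level) : Set (Level.suc (c ⊔ ℓ)) where
  field
    commutativeRing : CommutativeRing c ℓ
  open CommutativeRing commutativeRing public
  field
    _⁻¹      : Carrier → Carrier
    1≉0      : ¬ (1# ≈ 0#)
    inverseʳ : ∀ x → ¬ (x ≈ 0#) → x * (x ⁻¹) ≈ 1#

module _ {c ℓ : Level} (F : Field c ℓ) where
  open Field F

  -- Two-variable Laurent "series" represented by their values at
  -- nonzero arguments.
  Series₂ : Set c
  Series₂ = Carrier → Carrier → Carrier

  Orth : Series₂ → Series₂ → Set (c ⊔ ℓ)
  Orth f g = ∀ a b c x → ¬ (a ≈ 0#) → ¬ (b ≈ 0#) → ¬ (c ≈ 0#) → ¬ (x ≈ 0#) →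
    g a b * f x c - g a c * f x b + g b c * f x a ≈ 0#

  SelfOrth : Series₂ → Set (c ⊔ ℓ)
  SelfOrth f = Orth f f

  f₁ : Series₂
  f₁ x y = x - y

  f₂ : Carrier → Series₂
  f₂ d x y = (y - x) * (1# - x * y * (d ⁻¹))

  f₃ : Carrier → Carrier → Series₂
  f₃ a b x y = (x - y) * (1# - b * ((a * x * y) ⁻¹))

{-# OPTIONS --safe #-}
-- Each of the three series agrees, at nonzero arguments, with a 2×2 minor
-- u(x)v(y) − v(x)u(y) of two functions u, v, and for a minor the
-- orthogonality relation is the three-term Plücker relation
-- [ab][xc] − [ac][xb] + [bc][xa] = 0.  Explicitly x − y = x·1 − 1·y,
-- (y − x)(1 − xy/d) = (1 + x²/d)·y − x·(1 + y²/d), and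
-- (x − y)(1 − b/(axy)) = (x + k/x) − (y + k/y) with k = b/a.
module Submission where

open import Defs
open import Level using (_⊔_)
open import Relation.Nullary using (¬_)
open import Data.Product using (_×_; _,_)

open import Algebra.Bundles using (CommutativeRing)
open import Algebra.Solver.Ring.AlmostCommutativeRing
  using (fromCommutativeRing; _-Raw-AlmostCommutative⟶_)
import Algebra.Solver.Ring
import Algebra.Properties.AbelianGroup
import Algebra.Properties.CommutativeSemigroup
import Algebra.Properties.Ring
import Algebra.Properties.Semiring.Mult.TCOptimised
open import Data.Maybe.Base using (Maybe)
import Data.Maybe.Base as Maybe
open import Data.Nat.Base using (zero; suc)
import Data.Nat.Base as ℕ
import Data.Nat.Properties as ℕ
open import Data.Integer.Base using (ℤ; +_; -[1+_]; _⊖_; _◃_; sign; ∣_∣)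
import Data.Integer.Base as ℤ
import Data.Integer.Properties as ℤ
open import Data.Sign.Base using (Sign)
import Data.Sign.Base as Sign
open import Relation.Nullary.Decidable using (dec⇒maybe)
import Relation.Binary.PropositionalEquality as ≡
import Relation.Binary.Reasoning.Setoid as SetoidReasoning

-- The ring solver needs coefficients with a (weakly) decidable equality
-- and a homomorphism into the target ring; ℤ with its canonical map
-- serves every commutative ring.
module IntegerCoefficientSolver {c ℓ} (R : CommutativeRing c ℓ) where
  open CommutativeRing R
  open SetoidReasoning setoid
  open Algebra.Properties.AbelianGroup +-abelianGroup using (⁻¹-∙-comm; ε⁻¹≈ε; ⁻¹-involutive)
  open Algebra.Properties.Ring ring using (-1*x≈-x)
  open Algebra.Properties.Semiring.Mult.TCOptimised semiring
    renaming (_×_ to _·_) using (1+×; ×-homo-+; ×1-homo-*)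
  open Algebra.Properties.CommutativeSemigroup +-commutativeSemigroup
    using () renaming (interchange to +-interchange)
  open Algebra.Properties.CommutativeSemigroup *-commutativeSemigroup
    using () renaming (interchange to *-interchange)

  fromℤ : ℤ → Carrier
  fromℤ (+ n)    = n · 1#
  fromℤ -[1+ n ] = - (suc n · 1#)

  fromSign : Sign → Carrier
  fromSign Sign.+ = 1#
  fromSign Sign.- = - 1#

  fromSign-* : ∀ s t → fromSign (s Sign.* t) ≈ fromSign s * fromSign t
  fromSign-* Sign.+ t      = sym (*-identityˡ _)
  fromSign-* Sign.- Sign.+ = sym (*-identityʳ _)
  fromSign-* Sign.- Sign.- = sym (trans (-1*x≈-x (- 1#)) (⁻¹-involutive 1#))

  fromℤ-◃ : ∀ s n → fromℤ (s ◃ n) ≈ fromSign s * (n · 1#)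
  fromℤ-◃ s      zero    = sym (zeroʳ _)
  fromℤ-◃ Sign.+ (suc n) = sym (*-identityˡ _)
  fromℤ-◃ Sign.- (suc n) = sym (-1*x≈-x _)

  fromℤ-⊖ : ∀ m n → fromℤ (m ⊖ n) ≈ m · 1# - n · 1#
  fromℤ-⊖ m       zero    = sym (trans (+-congˡ ε⁻¹≈ε) (+-identityʳ _))
  fromℤ-⊖ zero    (suc n) = sym (+-identityˡ _)
  fromℤ-⊖ (suc m) (suc n) = begin
    fromℤ (suc m ⊖ suc n)                ≡⟨ ≡.cong fromℤ (ℤ.[1+m]⊖[1+n]≡m⊖n m n) ⟩
    fromℤ (m ⊖ n)                        ≈⟨ fromℤ-⊖ m n ⟩
    m · 1# - n · 1#                      ≈⟨ +-identityˡ _ ⟨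
    0# + (m · 1# - n · 1#)               ≈⟨ +-congʳ (-‿inverseʳ 1#) ⟨
    (1# - 1#) + (m · 1# - n · 1#)        ≈⟨ +-interchange 1# (- 1#) (m · 1#) (- (n · 1#)) ⟩
    (1# + m · 1#) + (- 1# - n · 1#)      ≈⟨ +-congˡ (⁻¹-∙-comm 1# (n · 1#)) ⟩
    (1# + m · 1#) - (1# + n · 1#)        ≈⟨ +-cong (1+× m 1#) (-‿cong (1+× n 1#)) ⟨
    suc m · 1# - suc n · 1#              ∎

  fromℤ-+ : ∀ i j → fromℤ (i ℤ.+ j) ≈ fromℤ i + fromℤ j
  fromℤ-+ (+ m)    (+ n)    = ×-homo-+ 1# m n
  fromℤ-+ (+ m)    -[1+ n ] = fromℤ-⊖ m (suc n)
  fromℤ-+ -[1+ m ] (+ n)    = trans (fromℤ-⊖ n (suc m)) (+-comm _ _)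
  fromℤ-+ -[1+ m ] -[1+ n ] = begin
    - (suc (suc (m ℕ.+ n)) · 1#)         ≡⟨ ≡.cong (λ k → - (k · 1#)) (ℕ.+-suc (suc m) n) ⟨
    - ((suc m ℕ.+ suc n) · 1#)           ≈⟨ -‿cong (×-homo-+ 1# (suc m) (suc n)) ⟩
    - (suc m · 1# + suc n · 1#)          ≈⟨ ⁻¹-∙-comm _ _ ⟨
    - (suc m · 1#) - suc n · 1#          ∎

  fromℤ-* : ∀ i j → fromℤ (i ℤ.* j) ≈ fromℤ i * fromℤ j
  fromℤ-* i j = begin
    fromℤ (sign i Sign.* sign j ◃ ∣ i ∣ ℕ.* ∣ j ∣)
      ≈⟨ fromℤ-◃ (sign i Sign.* sign j) (∣ i ∣ ℕ.* ∣ j ∣) ⟩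
    fromSign (sign i Sign.* sign j) * ((∣ i ∣ ℕ.* ∣ j ∣) · 1#)
      ≈⟨ *-cong (fromSign-* (sign i) (sign j)) (×1-homo-* ∣ i ∣ ∣ j ∣) ⟩
    (fromSign (sign i) * fromSign (sign j)) * (∣ i ∣ · 1# * ∣ j ∣ · 1#)
      ≈⟨ *-interchange _ _ _ _ ⟩
    (fromSign (sign i) * ∣ i ∣ · 1#) * (fromSign (sign j) * ∣ j ∣ · 1#)
      ≈⟨ *-cong (fromℤ-◃ (sign i) ∣ i ∣) (fromℤ-◃ (sign j) ∣ j ∣) ⟨
    fromℤ (sign i ◃ ∣ i ∣) * fromℤ (sign j ◃ ∣ j ∣)
      ≡⟨ ≡.cong₂ (λ i′ j′ → fromℤ i′ * fromℤ j′) (ℤ.◃-inverse i) (ℤ.◃-inverse j) ⟩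
    fromℤ i * fromℤ j ∎

  fromℤ-neg : ∀ i → fromℤ (ℤ.- i) ≈ - fromℤ i
  fromℤ-neg (+ zero)  = sym ε⁻¹≈ε
  fromℤ-neg (+ suc n) = refl
  fromℤ-neg -[1+ n ]  = sym (⁻¹-involutive _)

  fromℤ-homomorphism : ℤ.+-*-rawRing -Raw-AlmostCommutative⟶ fromCommutativeRing R
  fromℤ-homomorphism = record
    { ⟦_⟧    = fromℤ
    ; +-homo = fromℤ-+
    ; *-homo = fromℤ-*
    ; -‿homo = fromℤ-neg
    ; 0-homo = refl
    ; 1-homo = refl
    }

  fromℤ-≟ : ∀ i j → Maybe (fromℤ i ≈ fromℤ j)
  fromℤ-≟ i j = Maybe.map (λ i≡j → reflexive (≡.cong fromℤ i≡j)) (dec⇒maybe (i ℤ.≟ j))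

  open Algebra.Solver.Ring ℤ.+-*-rawRing (fromCommutativeRing R) fromℤ-homomorphism fromℤ-≟ public

module _ {c ℓ} (F : Field c ℓ) where
  open Field F
  open SetoidReasoning setoid
  open IntegerCoefficientSolver commutativeRing using (solve; _:+_; _:-_; _:*_; _:=_; con)

  invertible⇒≉0 : ∀ {x y} → x * y ≈ 1# → x ≉ 0#
  invertible⇒≉0 {x} {y} xy≈1 x≈0 = 1≉0 (begin
    1#     ≈⟨ xy≈1 ⟨
    x * y  ≈⟨ *-congʳ x≈0 ⟩
    0# * y ≈⟨ zeroˡ y ⟩
    0#     ∎)

  inverse-unique : ∀ {x y} → x * y ≈ 1# → y ≈ x ⁻¹
  inverse-unique {x} {y} xy≈1 = begin
    y                ≈⟨ *-identityʳ y ⟨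
    y * 1#           ≈⟨ *-congˡ (inverseʳ x (invertible⇒≉0 xy≈1)) ⟨
    y * (x * x ⁻¹)   ≈⟨ *-assoc y x (x ⁻¹) ⟨
    (y * x) * x ⁻¹   ≈⟨ *-congʳ (trans (*-comm y x) xy≈1) ⟩
    1# * x ⁻¹        ≈⟨ *-identityˡ (x ⁻¹) ⟩
    x ⁻¹             ∎

  x*y*[x⁻¹*y⁻¹]≈1 : ∀ {x y} → x ≉ 0# → y ≉ 0# → (x * y) * (x ⁻¹ * y ⁻¹) ≈ 1#
  x*y*[x⁻¹*y⁻¹]≈1 {x} {y} x≉0 y≉0 = begin
    (x * y) * (x ⁻¹ * y ⁻¹)  ≈⟨ *-interchange x y (x ⁻¹) (y ⁻¹) ⟩
    (x * x ⁻¹) * (y * y ⁻¹)  ≈⟨ *-cong (inverseʳ x x≉0) (inverseʳ y y≉0) ⟩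
    1# * 1#                  ≈⟨ *-identityʳ 1# ⟩
    1#                       ∎
    where open Algebra.Properties.CommutativeSemigroup *-commutativeSemigroup
            using () renaming (interchange to *-interchange)

  *-≉0 : ∀ {x y} → x ≉ 0# → y ≉ 0# → x * y ≉ 0#
  *-≉0 x≉0 y≉0 = invertible⇒≉0 (x*y*[x⁻¹*y⁻¹]≈1 x≉0 y≉0)

  ⁻¹-distrib-* : ∀ {x y} → x ≉ 0# → y ≉ 0# → (x * y) ⁻¹ ≈ x ⁻¹ * y ⁻¹
  ⁻¹-distrib-* x≉0 y≉0 = sym (inverse-unique (x*y*[x⁻¹*y⁻¹]≈1 x≉0 y≉0))

  AgreeOnNonzero : Series₂ F → Series₂ F → Set (c ⊔ ℓ)
  AgreeOnNonzero f g = ∀ x y → x ≉ 0# → y ≉ 0# → f x y ≈ g x y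

  Orth-resp : ∀ {f f′ g g′} → AgreeOnNonzero f f′ → AgreeOnNonzero g g′ →
              Orth F f g → Orth F f′ g′
  Orth-resp {f} {f′} {g} {g′} f≈f′ g≈g′ f⊥g a b c x a≉0 b≉0 c≉0 x≉0 = begin
    g′ a b * f′ x c - g′ a c * f′ x b + g′ b c * f′ x a
      ≈⟨ +-cong (+-cong (*-cong (g≈g′ a b a≉0 b≉0) (f≈f′ x c x≉0 c≉0))
                        (-‿cong (*-cong (g≈g′ a c a≉0 c≉0) (f≈f′ x b x≉0 b≉0))))
                (*-cong (g≈g′ b c b≉0 c≉0) (f≈f′ x a x≉0 a≉0)) ⟨
    g a b * f x c - g a c * f x b + g b c * f x a
      ≈⟨ f⊥g a b c x a≉0 b≉0 c≉0 x≉0 ⟩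
    0# ∎

  SelfOrth-resp : ∀ {f g} → AgreeOnNonzero f g → SelfOrth F f → SelfOrth F g
  SelfOrth-resp f≈g = Orth-resp f≈g f≈g

  minor : (Carrier → Carrier) → (Carrier → Carrier) → Series₂ F
  minor u v x y = u x * v y - v x * u y

  plücker : ∀ ua va ub vb uc vc ux vx →
    (ua * vb - va * ub) * (ux * vc - vx * uc)
      - (ua * vc - va * uc) * (ux * vb - vx * ub)
      + (ub * vc - vb * uc) * (ux * va - vx * ua) ≈ 0#
  plücker = solve 8 (λ ua va ub vb uc vc ux vx →
    (ua :* vb :- va :* ub) :* (ux :* vc :- vx :* uc)
      :- (ua :* vc :- va :* uc) :* (ux :* vb :- vx :* ub)
      :+ (ub :* vc :- vb :* uc) :* (ux :* va :- vx :* ua) := con (+ 0)) refl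

  minor-selfOrth : ∀ u v → SelfOrth F (minor u v)
  minor-selfOrth u v a b c x _ _ _ _ = plücker (u a) (v a) (u b) (v b) (u c) (v c) (u x) (v x)

  difference : (Carrier → Carrier) → Series₂ F
  difference u x y = u x - u y

  difference-selfOrth : ∀ u → SelfOrth F (difference u)
  difference-selfOrth u = SelfOrth-resp minor≈difference (minor-selfOrth u (λ _ → 1#))
    where
    minor≈difference : AgreeOnNonzero (minor u (λ _ → 1#)) (difference u)
    minor≈difference x y _ _ =
      solve 2 (λ ux uy → ux :* con (+ 1) :- con (+ 1) :* uy := ux :- uy) refl (u x) (u y)

  f₂≈minor : ∀ d → AgreeOnNonzero (minor (λ t → 1# + t * t * d ⁻¹) (λ t → t)) (f₂ F d)
  f₂≈minor d x y _ _ = solve 3 (λ x y e →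
    (con (+ 1) :+ x :* x :* e) :* y :- x :* (con (+ 1) :+ y :* y :* e)
      := (y :- x) :* (con (+ 1) :- x :* y :* e)) refl x y (d ⁻¹)

  f₃≈difference : ∀ {a} b → a ≉ 0# →
    AgreeOnNonzero (difference (λ t → t + b * a ⁻¹ * t ⁻¹)) (f₃ F a b)
  f₃≈difference {a} b a≉0 x y x≉0 y≉0 = sym (begin
    (x - y) * (1# - b * (a * x * y) ⁻¹)
      ≈⟨ *-congˡ (+-congˡ (-‿cong (*-congˡ [axy]⁻¹≈a⁻¹x⁻¹y⁻¹))) ⟩
    (x - y) * (1# - b * (a ⁻¹ * x ⁻¹ * y ⁻¹))
      ≈⟨ solve 6 (λ x y b A X Y →
           (x :- y) :* (con (+ 1) :- b :* (A :* X :* Y))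
             := (x :+ b :* A :* (y :* Y :* X)) :- (y :+ b :* A :* (x :* X :* Y)))
           refl x y b (a ⁻¹) (x ⁻¹) (y ⁻¹) ⟩
    (x + k * (y * y ⁻¹ * x ⁻¹)) - (y + k * (x * x ⁻¹ * y ⁻¹))
      ≈⟨ +-cong (+-congˡ (*-congˡ (t*t⁻¹*s≈s y≉0 (x ⁻¹))))
                (-‿cong (+-congˡ (*-congˡ (t*t⁻¹*s≈s x≉0 (y ⁻¹))))) ⟩
    (x + k * x ⁻¹) - (y + k * y ⁻¹) ∎)
    where
    k : Carrier
    k = b * a ⁻¹

    [axy]⁻¹≈a⁻¹x⁻¹y⁻¹ : (a * x * y) ⁻¹ ≈ a ⁻¹ * x ⁻¹ * y ⁻¹
    [axy]⁻¹≈a⁻¹x⁻¹y⁻¹ = trans (⁻¹-distrib-* (*-≉0 a≉0 x≉0) y≉0)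
                              (*-congʳ (⁻¹-distrib-* a≉0 x≉0))

    t*t⁻¹*s≈s : ∀ {t} → t ≉ 0# → ∀ s → t * t ⁻¹ * s ≈ s
    t*t⁻¹*s≈s {t} t≉0 s = trans (*-congʳ (inverseʳ t t≉0)) (*-identityˡ s)

corollary2p1 : ∀ {c ℓ} (F : Field c ℓ) (d a b : Field.Carrier F) →
    ¬ (Field._≈_ F d (Field.0# F)) → ¬ (Field._≈_ F a (Field.0# F)) →
    SelfOrth F (f₁ F) × SelfOrth F (f₂ F d) × SelfOrth F (f₃ F a b)
corollary2p1 F d a b _ a≉0 =
    difference-selfOrth F (λ t → t)
  , SelfOrth-resp F (f₂≈minor F d) (minor-selfOrth F _ _)
  , SelfOrth-resp F (f₃≈difference F b a≉0) (difference-selfOrth F _)
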